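{- Let $\Gamma$ be an undirected simple graph. Then $\Gamma$ admits no $k$-extended irregular dominating set for $k=2$ and for $k=3$.
   Context: Let $\Gamma=(V,E)$ be an undirected simple graph with graph distance $d$. A vertex $v$ carrying a positive integer label $\ell$ dominates (covers) exactly the vertices $u$ with $d(u,v)=\ell$; a vertex carrying label $0$ dominates only itself. For $k\ge 0$, a $k$-extended irregular dominating set is a set $S\subseteq V$ of $k$ vertices together with an injective labeling $\lambda:S\to\{0,1,2,\dots\}$ (distinct non-negative labels) such that every vertex of $V$ is dominated by at least one vertex of $S$; it is always assumed that some vertex of $S$ has label $0$ (so exactly one vertex has label $0$). -}

module Defs where

open import Level using (0ℓ)
open import Data.Nat using (ℕ; zero; suc; _<_; _>_)
open import Data.Fin using (Fin)
open import Data.Product using (Σ; _×_; ∃)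
open import Data.Sum using (_⊎_)
open import Relation.Nullary using (¬_)
open import Relation.Binary.PropositionalEquality using (_≡_)
open import Function.Definitions using (Injective)

record Graph (n : ℕ) : Set₁ where
  field
    Adj   : Fin n → Fin n → Set
    sym   : ∀ {u v} → Adj u v → Adj v u
    irrefl : ∀ {v} → ¬ Adj v v

module _ {n : ℕ} (Γ : Graph n) where
  open Graph Γ

  data Walk : Fin n → Fin n → ℕ → Set where
    here : ∀ {u} → Walk u u zero
    step : ∀ {u w v m} → Adj u w → Walk w v m → Walk u v (suc m)

  Dist : Fin n → Fin n → ℕ → Set
  Dist u v ℓ = Walk u v ℓ × (∀ m → m < ℓ → ¬ Walk u v m)

  Dominates : Fin n → ℕ → Fin n → Set
  Dominates v zero    u = u ≡ v
  Dominates v (suc p) u = Dist u v (suc p)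

  record ExtIrregularDominatingSet (k : ℕ) : Set where
    field
      vert        : Fin k → Fin n
      vert-inj    : Injective _≡_ _≡_ vert
      label       : Fin k → ℕ
      label-inj   : Injective _≡_ _≡_ label
      has-zero    : ∃ λ i → label i ≡ 0
      dominating  : ∀ u → ∃ λ i → Dominates (vert i) (label i) u

-- Let z be the member labelled 0. Every other member j must be dominated by a
-- member i ≠ j with positive label, at distance label i, and i ≠ z. With k = 2
-- no such i exists. With k = 3 the member dominating i can only be j, so
-- d(j,i) = label i and d(i,j) = label j; symmetry of the distance then forces
-- label i = label j, against injectivity of the labelling.
module Submission where

open import Defs
open import Data.Nat using (ℕ; zero; suc; z<s)
open import Data.Nat.Properties using (≤-antisym; ≮⇒≥)
open import Data.Fin using (Fin; zero; suc; punchIn; punchOut)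
open import Data.Fin.Properties using (punchInᵢ≢i; punchOut-injective)
open import Data.Product using (_×_; ∃; _,_)
open import Data.Sum using (_⊎_; inj₁; inj₂)
open import Function using (_∘_)
open import Relation.Nullary using (¬_; contradiction)
open import Relation.Binary.PropositionalEquality using (_≡_; _≢_; refl; sym; trans; cong; subst)

≢-Fin2 : {y x w : Fin 2} → y ≢ x → y ≢ w → x ≡ w
≢-Fin2 {zero}     {zero}                y≢x _   = contradiction refl y≢x
≢-Fin2 {suc zero} {suc zero}            y≢x _   = contradiction refl y≢x
≢-Fin2 {zero}     {suc zero} {zero}     _   y≢w = contradiction refl y≢w
≢-Fin2 {zero}     {suc zero} {suc zero} _   _   = refl
≢-Fin2 {suc zero} {zero}     {zero}     _   _   = refl
≢-Fin2 {suc zero} {zero}     {suc zero} _   y≢w = contradiction refl y≢w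

punchOut-≢ : ∀ {m} {i j k : Fin (suc m)} (i≢j : i ≢ j) (i≢k : i ≢ k) →
             j ≢ k → punchOut i≢j ≢ punchOut i≢k
punchOut-≢ i≢j i≢k j≢k = j≢k ∘ punchOut-injective i≢j i≢k

≢-Fin3 : {z a b c : Fin 3} (z≢a : z ≢ a) (z≢b : z ≢ b) (z≢c : z ≢ c) →
         b ≢ a → b ≢ c → a ≡ c
≢-Fin3 z≢a z≢b z≢c b≢a b≢c = punchOut-injective z≢a z≢c
  (≢-Fin2 (punchOut-≢ z≢b z≢a b≢a) (punchOut-≢ z≢b z≢c b≢c))

module _ {n : ℕ} (Γ : Graph n) where
  open Graph Γ using (Adj) renaming (sym to Adj-sym)

  snoc : ∀ {u v w m} → Walk Γ u v m → Adj v w → Walk Γ u w (suc m)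
  snoc here       b = step b here
  snoc (step a w) b = step a (snoc w b)

  reverse : ∀ {u v m} → Walk Γ u v m → Walk Γ v u m
  reverse here       = here
  reverse (step a w) = snoc (reverse w) (Adj-sym a)

  Dist-sym : ∀ {u v ℓ} → Dist Γ u v ℓ → Dist Γ v u ℓ
  Dist-sym (w , shortest) = reverse w , λ m m<ℓ → shortest m m<ℓ ∘ reverse

  Dist-functional : ∀ {u v p q} → Dist Γ u v p → Dist Γ u v q → p ≡ q
  Dist-functional (w₁ , shortest₁) (w₂ , shortest₂) =
    ≤-antisym (≮⇒≥ λ q<p → shortest₁ _ q<p w₂) (≮⇒≥ λ p<q → shortest₂ _ p<q w₁)

  Dist-pos⇒≢ : ∀ {u v ℓ} → Dist Γ u v ℓ → ℓ ≢ 0 → u ≢ v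
  Dist-pos⇒≢ {ℓ = zero}  _              ℓ≢0 _    = ℓ≢0 refl
  Dist-pos⇒≢ {ℓ = suc _} (_ , shortest) _   refl = shortest 0 z<s here

  Dominates-cases : ∀ {u v} ℓ → Dominates Γ v ℓ u →
                    (ℓ ≡ 0 × u ≡ v) ⊎ (ℓ ≢ 0 × Dist Γ u v ℓ)
  Dominates-cases zero    u≡v  = inj₁ (refl , u≡v)
  Dominates-cases (suc _) dist = inj₂ ((λ ()) , dist)

  module _ {k : ℕ} (D : ExtIrregularDominatingSet Γ k) where
    open ExtIrregularDominatingSet D

    dominated-by-other : ∀ j → label j ≢ 0 →
      ∃ λ i → i ≢ j × label i ≢ 0 × Dist Γ (vert j) (vert i) (label i)
    dominated-by-other j lj≢0 with dominating (vert j)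
    ... | i , dom with Dominates-cases (label i) dom
    ... | inj₁ (li≡0 , vj≡vi) = contradiction (trans (cong label (vert-inj vj≡vi)) li≡0) lj≢0
    ... | inj₂ (li≢0 , dist)  =
      i , (λ i≡j → Dist-pos⇒≢ dist li≢0 (cong vert (sym i≡j))) , li≢0 , dist

    mutually-dominating⇒≡ : ∀ {i j} → Dist Γ (vert j) (vert i) (label i) →
                            Dist Γ (vert i) (vert j) (label j) → i ≡ j
    mutually-dominating⇒≡ dji dij = label-inj (Dist-functional (Dist-sym dji) dij)

    label≢0⇒≢ : ∀ {z i} → label z ≡ 0 → label i ≢ 0 → z ≢ i
    label≢0⇒≢ lz≡0 li≢0 refl = li≢0 lz≡0

    ≢⇒label≢0 : ∀ {z j} → label z ≡ 0 → z ≢ j → label j ≢ 0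
    ≢⇒label≢0 lz≡0 z≢j lj≡0 = z≢j (label-inj (trans lz≡0 (sym lj≡0)))

no-ExtIrregularDominatingSet-2 : ∀ {n} (Γ : Graph n) → ¬ ExtIrregularDominatingSet Γ 2
no-ExtIrregularDominatingSet-2 Γ D =
  let open ExtIrregularDominatingSet D
      (z , lz≡0) = has-zero
      j = punchIn z zero
      z≢j = punchInᵢ≢i z zero ∘ sym
      (i , i≢j , li≢0 , _) = dominated-by-other Γ D j (≢⇒label≢0 Γ D lz≡0 z≢j)
  in i≢j (≢-Fin2 (label≢0⇒≢ Γ D lz≡0 li≢0) z≢j)

no-ExtIrregularDominatingSet-3 : ∀ {n} (Γ : Graph n) → ¬ ExtIrregularDominatingSet Γ 3
no-ExtIrregularDominatingSet-3 Γ D =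
  let open ExtIrregularDominatingSet D
      (z , lz≡0) = has-zero
      j = punchIn z zero
      z≢j = punchInᵢ≢i z zero ∘ sym
      (i , i≢j , li≢0 , dji) = dominated-by-other Γ D j (≢⇒label≢0 Γ D lz≡0 z≢j)
      (i′ , i′≢i , li′≢0 , dii′) = dominated-by-other Γ D i li≢0
      j≡i′ = ≢-Fin3 z≢j (label≢0⇒≢ Γ D lz≡0 li≢0) (label≢0⇒≢ Γ D lz≡0 li′≢0) i≢j (i′≢i ∘ sym)
      di′i = subst (λ x → Dist Γ (vert x) (vert i) (label i)) j≡i′ dji
  in i′≢i (sym (mutually-dominating⇒≡ Γ D di′i dii′))

proposition2p2 : ∀ {n : ℕ} (Γ : Graph n) (k : ℕ) → (k ≡ 2 ⊎ k ≡ 3)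
                 → ¬ ExtIrregularDominatingSet Γ k
proposition2p2 Γ .2 (inj₁ refl) = no-ExtIrregularDominatingSet-2 Γ
proposition2p2 Γ .3 (inj₂ refl) = no-ExtIrregularDominatingSet-3 Γ
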